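{- Let $w$ be a word of length $n$ and $1\le i\le n$. If $\mathsf{LSF}_\ell[i]=0$ then $\mathsf{LUF}[i]=n-i+1$.
   Context: For a word $w=w[1]\cdots w[n]$, $w[i\mathinner{.\,.} j]$ denotes the factor $w[i]\cdots w[j]$. A border of a word $x$ is a (possibly empty) word $u\neq x$ that is both a prefix and a suffix of $x$; $x$ is unbordered if its only border is the empty word. $\mathsf{LUF}[i]$ is the length of the longest unbordered prefix of $w[i\mathinner{.\,.} n]$. The longest successor factor array is defined by $\mathsf{LSF}_\ell[n]=0$ and, for $i<n$, $\mathsf{LSF}_\ell[i]=\max\{k\ge 0 : w[i\mathinner{.\,.} i+k-1]=w[j\mathinner{.\,.} j+k-1]\text{ for some } j \text{ with } i<j\le n\}$ (factors not extending beyond position $n$), i.e. the length of the longest factor starting at $i$ that also occurs at some position $j>i$. -}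

module Defs where

open import Data.Nat using (ℕ; zero; suc; _+_; _∸_; _≤_; _<_)
open import Data.Fin using (Fin; toℕ)
open import Data.Product using (Σ; _×_; ∃-syntax)
open import Relation.Binary.PropositionalEquality using (_≡_)
open import Relation.Nullary using (¬_)

-- Positions are 1-based as in the paper: position p (1 ≤ p ≤ n) is w at Fin index p-1.
-- Characters at 1-based position p, given as a Fin index whose value is p - 1.
-- "w[a .. a+k-1] = w[b .. b+k-1]" for 1-based a, b, with both factors inside [1..n].
SameFactor : ∀ {A : Set} {n : ℕ} → (Fin n → A) → ℕ → ℕ → ℕ → Set
SameFactor {n = n} w a b k =
  (a + k ∸ 1 ≤ n) × (b + k ∸ 1 ≤ n) ×
  (∀ (p q : Fin n) (t : ℕ) → t < k →
     toℕ p ≡ a ∸ 1 + t → toℕ q ≡ b ∸ 1 + t → w p ≡ w q)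

HasBorderOfLength : ∀ {A : Set} {n : ℕ} → (Fin n → A) → ℕ → ℕ → ℕ → Set
HasBorderOfLength w i m b = (0 < b) × (b < m) × SameFactor w i (i + m ∸ b) b

UnborderedPrefix : ∀ {A : Set} {n : ℕ} → (Fin n → A) → ℕ → ℕ → Set
UnborderedPrefix w i m = ∀ b → ¬ HasBorderOfLength w i m b

IsLUF : ∀ {A : Set} {n : ℕ} → (Fin n → A) → ℕ → ℕ → Set
IsLUF {n = n} w i ℓ =
  (ℓ ≤ n + 1 ∸ i) × UnborderedPrefix w i ℓ ×
  (∀ m → m ≤ n + 1 ∸ i → UnborderedPrefix w i m → m ≤ ℓ)

OccursLater : ∀ {A : Set} {n : ℕ} → (Fin n → A) → ℕ → ℕ → Set
OccursLater {n = n} w i k = ∃[ j ] (i < j × j ≤ n × SameFactor w i j k)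

IsLSF : ∀ {A : Set} {n : ℕ} → (Fin n → A) → ℕ → ℕ → Set
IsLSF {n = n} w i ℓ =
  (i ≡ n → ℓ ≡ 0) ×
  (i < n → OccursLater w i ℓ × (∀ k → OccursLater w i k → k ≤ ℓ))

module Submission where

open import Defs
open import Data.Nat using (ℕ; _+_; _∸_; _≤_; _<_)
open import Data.Nat.Properties
open import Data.Fin using (Fin)
open import Data.Product using (_,_; proj₂)
open import Data.Sum using (inj₁; inj₂)
open import Data.Empty using (⊥-elim)
open import Relation.Binary.PropositionalEquality using (_≡_; refl; sym; subst)

-- A border of length b of w[i..i+m-1] is an occurrence of w[i..i+b-1] at j = i + m - b > i,
-- so LSF[i] = 0 leaves no room for a nonempty border of any prefix of w[i..n].

border⇒occursLater : ∀ {A : Set} {n : ℕ} (w : Fin n → A) {i m b : ℕ} →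
  HasBorderOfLength w i m b → OccursLater w i b
border⇒occursLater {n = n} w {i} {m} {b} (0<b , b<m , sf@(_ , j+b∸1≤n , _)) =
  i + m ∸ b , i<j , j≤n , sf
  where
  i<j : i < i + m ∸ b
  i<j = subst (i <_) (sym (+-∸-assoc i (<⇒≤ b<m))) (m<m+n i (m<n⇒0<n∸m b<m))

  j≤j+b∸1 : ∀ {j} → j ≤ j + b ∸ 1
  j≤j+b∸1 {j} = subst (j ≤_) (sym (+-∸-assoc j 0<b)) (m≤m+n j (b ∸ 1))

  j≤n : i + m ∸ b ≤ n
  j≤n = ≤-trans j≤j+b∸1 j+b∸1≤n

occursLater-lsf0⇒empty : ∀ {A : Set} {n : ℕ} (w : Fin n → A) {i k : ℕ} →
  i ≤ n → IsLSF w i 0 → OccursLater w i k → k ≡ 0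
occursLater-lsf0⇒empty w i≤n (_ , lsf-max) occ@(j , i<j , j≤n , _)
  with m≤n⇒m<n∨m≡n i≤n
... | inj₁ i<n = n≤0⇒n≡0 (proj₂ (lsf-max i<n) _ occ)
... | inj₂ refl = ⊥-elim (<-irrefl refl (<-≤-trans i<j j≤n))

lsf0⇒unborderedPrefix : ∀ {A : Set} {n : ℕ} (w : Fin n → A) {i : ℕ} (m : ℕ) →
  i ≤ n → IsLSF w i 0 → UnborderedPrefix w i m
lsf0⇒unborderedPrefix w m i≤n lsf b border@(0<b , _) =
  <-irrefl (sym (occursLater-lsf0⇒empty w i≤n lsf (border⇒occursLater w border))) 0<b

lemma1 : {A : Set} (n : ℕ) (w : Fin n → A) (i : ℕ) → 1 ≤ i → i ≤ n →
    IsLSF w i 0 → IsLUF w i (n + 1 ∸ i)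
lemma1 n w i _ i≤n lsf =
  ≤-refl , lsf0⇒unborderedPrefix w (n + 1 ∸ i) i≤n lsf , λ _ m≤ _ → m≤
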